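{- Let $a\in\mathbb{Q}$, $c=-1+a-a^2$, $f(x)=x^2+c$, and let $p$ be a prime. Then: (1) The following are equivalent: (i) $v_p(a)<0$; (ii) $v_p(f^n(0)-a)<0$ for some $n\ge1$; (iii) $v_p(f^n(0)-a)<0$ for all $n\ge1$. (2) If $v_2(a)>0$, then $v_2(f^n(0)-a)>0$ for all even $n\ge2$ and $v_2(f^n(0)-a)=0$ for all odd $n\ge1$. (3) If $v_2(a)=1$, then $v_2(f^n(0)-a)=2$ for all even $n\ge2$ and $v_2(f^n(0)-a)=0$ for all odd $n\ge1$. (4) If $v_2(a)=0$, then $v_2(f^n(0)-a)=1$ for all odd $n\ge1$ and $v_2(f^n(0)-a)=0$ for all even $n\ge0$. (5) If $v_p(f^m(0)-a)>0$ and $v_p(f^n(0)-a)>0$ for some $m,n\ge1$ with $m\ne n$, then $v_p(2a)>0$.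
   Context: $v_p$ is the $p$-adic valuation on $\mathbb{Q}$ (with $v_p(0)=\infty$); $f^n$ denotes the $n$-th iterate of $f$, $f^0$ the identity. -}

module Defs where

open import Data.Nat as ℕ using (ℕ; zero; suc; _≡ᵇ_)
open import Data.Nat.DivMod using (_/_; _%_)
open import Data.Integer as ℤ using (ℤ; +_; _-_)
open import Data.Rational as ℚ using (ℚ; mkℚ)
open import Data.Bool using (if_then_else_)

-- Implemented with fuel n, which suffices since
-- each division by p ≥ 2 strictly decreases a positive number.
-- (Values for n = 0 or p < 2 are junk and never used below on such inputs
-- except for p a prime.)
vℕ : ℕ → ℕ → ℕ
vℕ zero    n = 0
vℕ (suc k) n = go n n
  where
  go : ℕ → ℕ → ℕ
  go zero       m = 0
  go (suc fuel) zero = 0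
  go (suc fuel) (suc m) =
    if (suc m % suc k) ≡ᵇ 0 then suc (go fuel (suc m / suc k)) else 0

data ℤ∞ : Set where
  fin : ℤ → ℤ∞
  ∞   : ℤ∞

data _<∞_ : ℤ∞ → ℤ∞ → Set where
  fin<fin : ∀ {a b} → a ℤ.< b → fin a <∞ fin b
  fin<∞   : ∀ {a} → fin a <∞ ∞

v : ℕ → ℚ → ℤ∞
v p (mkℚ num den-1 _) with ℤ.∣ num ∣
... | zero  = ∞
... | suc k = fin (+ vℕ p (suc k) - + vℕ p (suc den-1))

iter : {A : Set} → (A → A) → ℕ → A → A
iter f zero    x = x
iter f (suc n) x = f (iter f n x)

cParam : ℚ → ℚ
cParam a = (ℚ.- ℚ.1ℚ) ℚ.+ a ℚ.- a ℚ.* a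

fMap : ℚ → ℚ → ℚ
fMap a x = x ℚ.* x ℚ.+ cParam a

orbitDiff : ℚ → ℕ → ℚ
orbitDiff a n = iter (fMap a) n ℚ.0ℚ ℚ.- a

{-# OPTIONS --safe #-}
module Submission where

-- Put yₙ = fⁿ(0) - a.  Then y₀ = -a and yₙ₊₁ = yₙ (yₙ + 2a) - 1, which factors in two ways:
-- yₙ₊₁ + 1 = yₙ (yₙ + 2a) and yₙ₊₁ + 2a = (yₙ + 1) (yₙ - 1 + 2a).  With a = N / D in lowest
-- terms, yₙ = Aₙ / (D gₙ) for the integers g₀ = 1, gₙ₊₁ = gₙ² D, A₀ = -N and
-- Aₙ₊₁ = Aₙ (Aₙ + 2 N gₙ) - (D gₙ)².
-- If p ∣ D, then modulo p the factorisations make both Aₙ₊₁ and Aₙ₊₁ + 2 N gₙ₊₁ congruent to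
-- Aₙ (Aₙ + 2 N gₙ), so p never divides Aₙ and every yₙ has a pole at p; this gives (1).
-- If p ∤ D, the denominators D gₙ are prime to p and vₚ(yₙ) is read off Aₙ.  By the
-- factorisations, once yₘ ≡ 0 (mod p) the later terms alternate between -1 and -2a (mod p),
-- which gives (5).  For p = 2, tracking Aₙ modulo 2, 4 and 8 (odd squares are 1 mod 8)
-- gives (2)-(4).

open import Defs
open import Data.Nat.Base using (ℕ)
open import Data.Nat.Primality using (Prime)
open import Data.Integer.Base using (ℤ)
open import Data.Rational.Base using (ℚ)

module Valuationℕ where
  open import Data.Nat.Base
  open import Data.Nat.Properties using (0≢1+n; ≤-trans; *-mono-≤)
  open import Data.Nat.DivMod using (_%_; _/_; m≥n⇒m/n>0)
  open import Data.Nat.Divisibility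
  open import Relation.Nullary using (¬_; contradiction)
  open import Relation.Binary.PropositionalEquality

  private
    variable
      p n r : ℕ

  ∣⇒%≢suc : .{{_ : NonZero p}} → p ∣ n → n % p ≢ suc r
  ∣⇒%≢suc {p} {n} p∣n eq = 0≢1+n (trans (sym (n∣m⇒m%n≡0 n p p∣n)) eq)

  ∣⇒/≢0 : .{{_ : NonZero n}} .{{_ : NonZero p}} → p ∣ n → n / p ≢ 0
  ∣⇒/≢0 p∣n eq = contradiction (subst (0 <_) eq (m≥n⇒m/n>0 (∣⇒≤ p∣n))) λ ()

  p*p∣n⇒4≤n : .{{_ : NonZero n}} .{{_ : NonTrivial p}} → p * p ∣ n → 4 ≤ n
  p*p∣n⇒4≤n {n} {p} p²∣n = ≤-trans (*-mono-≤ 2≤p 2≤p) (∣⇒≤ p²∣n)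
    where 2≤p = nonTrivial⇒n>1 p

  -- vℕ is computed by a fuelled loop local to its definition, so it can only be evaluated a
  -- fixed number of steps deep: there is one lemma per value needed.

  vℕ-∤ : .{{_ : NonZero n}} → ¬ p ∣ n → vℕ p n ≡ 0
  vℕ-∤ {suc _} {zero} _ = refl
  vℕ-∤ {n@(suc _)} {p@(suc _)} p∤n with n % p in eq
  ... | zero  = contradiction (m%n≡0⇒n∣m n p eq) p∤n
  ... | suc _ = refl

  vℕ-∣ : .{{_ : NonZero n}} → p ∣ n → 1 ≤ vℕ p n
  vℕ-∣ {suc _} {zero} 0∣n = contradiction (0∣⇒≡0 0∣n) λ ()
  vℕ-∣ {n@(suc _)} {p@(suc _)} p∣n with n % p in eq
  ... | zero  = s≤s z≤n
  ... | suc _ = contradiction eq (∣⇒%≢suc p∣n)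

  vℕ-∥ : .{{_ : NonZero n}} → p ∣ n → ¬ p * p ∣ n → vℕ p n ≡ 1
  vℕ-∥ {1} p∣1 p²∤1 = contradiction (subst (λ p → p * p ∣ 1) (sym (∣1⇒≡1 p∣1)) ∣-refl) p²∤1
  vℕ-∥ {suc (suc _)} {zero} 0∣n _ = contradiction (0∣⇒≡0 0∣n) λ ()
  vℕ-∥ {n@(suc (suc _))} {p@(suc _)} p∣n p²∤n with n % p in eq₁ | n / p in eq₂
  ... | suc _ | _     = contradiction eq₁ (∣⇒%≢suc p∣n)
  ... | zero  | zero  = contradiction eq₂ (∣⇒/≢0 p∣n)
  ... | zero  | suc j with suc j % p in eq₃
  ...   | suc _ = refl
  ...   | zero  = contradiction (m∣n/o⇒o*m∣n p∣n (subst (p ∣_) (sym eq₂) (m%n≡0⇒n∣m (suc j) p eq₃))) p²∤n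

  vℕ-∣² : .{{_ : NonZero n}} .{{_ : NonTrivial p}} → p * p ∣ n → 2 ≤ vℕ p n
  vℕ-∣² {1} p²∣1 = contradiction (p*p∣n⇒4≤n p²∣1) λ { (s≤s ()) }
  vℕ-∣² {n@(suc (suc _))} {p@(suc _)} p²∣n
    with n % p in eq₁ | n / p in eq₂ | m*n∣o⇒n∣o/m p p p²∣n
  ... | suc _ | _     | _     = contradiction eq₁ (∣⇒%≢suc (m*n∣⇒m∣ p p p²∣n))
  ... | zero  | zero  | _     = contradiction eq₂ (∣⇒/≢0 (m*n∣⇒m∣ p p p²∣n))
  ... | zero  | suc j | p∣n/p with suc j % p in eq₃
  ...   | suc _ = contradiction eq₃ (∣⇒%≢suc p∣n/p)
  ...   | zero  = s≤s (s≤s z≤n)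

  vℕ-∥² : .{{_ : NonZero n}} .{{_ : NonTrivial p}} → p * p ∣ n → ¬ p * (p * p) ∣ n → vℕ p n ≡ 2
  vℕ-∥² {1} p²∣1 _ = contradiction (p*p∣n⇒4≤n p²∣1) λ { (s≤s ()) }
  vℕ-∥² {2} p²∣2 _ = contradiction (p*p∣n⇒4≤n p²∣2) λ { (s≤s (s≤s ())) }
  vℕ-∥² {n@(suc (suc (suc _)))} {p@(suc _)} p²∣n p³∤n
    with n % p in eq₁ | n / p in eq₂ | m*n∣o⇒n∣o/m p p p²∣n
  ... | suc _ | _     | _     = contradiction eq₁ (∣⇒%≢suc (m*n∣⇒m∣ p p p²∣n))
  ... | zero  | zero  | _     = contradiction eq₂ (∣⇒/≢0 (m*n∣⇒m∣ p p p²∣n))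
  ... | zero  | suc j | p∣n/p with suc j % p in eq₃ | suc j / p in eq₄
  ...   | suc _ | _     = contradiction eq₃ (∣⇒%≢suc p∣n/p)
  ...   | zero  | zero  = contradiction eq₄ (∣⇒/≢0 p∣n/p)
  ...   | zero  | suc i with suc i % p in eq₅
  ...     | suc _ = refl
  ...     | zero  = contradiction (m∣n/o⇒o*m∣n (m*n∣⇒m∣ p p p²∣n) (subst (p * p ∣_) (sym eq₂) p²∣n/p)) p³∤n
    where
    p²∣n/p : p * p ∣ suc j
    p²∣n/p = m∣n/o⇒o*m∣n p∣n/p (subst (p ∣_) (sym eq₄) (m%n≡0⇒n∣m (suc i) p eq₅))

module PrimeDivisibility where
  open import Data.Nat.Base
  open import Data.Nat.Divisibility
  open import Data.Nat.Coprimality using (Coprime; coprime-divisor)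
  open import Data.Nat.Primality using (prime⇒irreducible; euclidsLemma)
  import Data.Integer.Base as ℤ
  open import Data.Integer.Base using (+_; ∣_∣)
  open import Data.Integer.Properties using (abs-*)
  open import Data.Integer.Divisibility.Signed using (∣ᵤ⇒∣; ∣⇒∣ᵤ) renaming (_∣_ to _∣ℤ_)
  open import Data.Product using (_,_)
  open import Data.Sum as Sum using (_⊎_; inj₁; inj₂)
  open import Relation.Nullary using (¬_; contradiction)
  open import Relation.Binary.PropositionalEquality using (refl; subst)

  private
    variable
      a b d n p : ℕ

  prime∤⇒coprime : Prime p → ¬ p ∣ n → Coprime p n
  prime∤⇒coprime pr p∤n (i∣p , i∣n) with prime⇒irreducible pr i∣p
  ... | inj₁ i≡1 = i≡1
  ... | inj₂ refl = contradiction i∣n p∤n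

  coprime-∣ʳ : Coprime a n → d ∣ n → Coprime a d
  coprime-∣ʳ a⊥n d∣n (i∣a , i∣d) = a⊥n (i∣a , ∣-trans i∣d d∣n)

  coprime-*ˡ : Coprime a n → Coprime b n → Coprime (a * b) n
  coprime-*ˡ a⊥n b⊥n (i∣ab , i∣n) =
    b⊥n (coprime-divisor (λ (j∣i , j∣a) → a⊥n (j∣a , ∣-trans j∣i i∣n)) i∣ab , i∣n)

  euclidsLemmaℤ : Prime p → ∀ x y → + p ∣ℤ x ℤ.* y → + p ∣ℤ x ⊎ + p ∣ℤ y
  euclidsLemmaℤ {p} pr x y p∣xy =
    Sum.map ∣ᵤ⇒∣ ∣ᵤ⇒∣ (euclidsLemma ∣ x ∣ ∣ y ∣ pr (subst (p ∣_) (abs-* x y) (∣⇒∣ᵤ p∣xy)))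

module Fraction where
  open import Data.Nat.Base as ℕ using ()
  open import Data.Integer.Base
  open import Data.Integer.Properties using (*-cancelʳ-≡; i*j≢0; pos-*; neg-distribˡ-*)
  open import Data.Integer.GCD using (gcd)
  open import Data.Integer.Tactic.RingSolver using (solve-∀)
  open import Data.Rational.Base as ℚ using (mkℚ; ↥_; ↧_; ↧ₙ_)
  import Data.Rational.Properties as ℚP
  open import Relation.Binary.PropositionalEquality

  infix 4 _≐_/_
  data _≐_/_ (q : ℚ) (X Y : ℤ) : Set where
    *≡* : .{{_ : NonZero Y}} → ↥ q * Y ≡ X * ↧ q → q ≐ X / Y

  ≐-refl : ∀ q → q ≐ ↥ q / ↧ q
  ≐-refl q = *≡* refl

  ≐-/ : ∀ i n .{{_ : ℕ.NonZero n}} → i ℚ./ n ≐ i / + n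
  ≐-/ i n = *≡* (begin
    ↥ i/n * + n          ≡⟨ cong (↥ i/n *_) (sym (ℚP.↧-/ i n)) ⟩
    ↥ i/n * (↧ i/n * g)  ≡⟨ swap (↥ i/n) (↧ i/n) g ⟩
    (↥ i/n * g) * ↧ i/n  ≡⟨ cong (_* ↧ i/n) (ℚP.↥-/ i n) ⟩
    i * ↧ i/n            ∎)
    where
    open ≡-Reasoning
    i/n = i ℚ./ n
    g = gcd i (+ n)
    swap : ∀ a b c → a * (b * c) ≡ (a * c) * b
    swap = solve-∀

  ≐-rescale : ∀ {q X Y X′ Y′} .{{_ : NonZero Y′}} → q ≐ X / Y → X * Y′ ≡ X′ * Y → q ≐ X′ / Y′
  ≐-rescale {q} {X} {Y} {X′} {Y′} (*≡* q≐X/Y) XY′≡X′Y = *≡* (*-cancelʳ-≡ _ _ Y (begin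
    ↥ q * Y′ * Y     ≡⟨ swap (↥ q) Y′ Y ⟩
    ↥ q * Y * Y′     ≡⟨ cong (_* Y′) q≐X/Y ⟩
    X * ↧ q * Y′     ≡⟨ swap X (↧ q) Y′ ⟩
    X * Y′ * ↧ q     ≡⟨ cong (_* ↧ q) XY′≡X′Y ⟩
    X′ * Y * ↧ q     ≡⟨ swap X′ Y (↧ q) ⟩
    X′ * ↧ q * Y     ∎))
    where
    open ≡-Reasoning
    swap : ∀ a b c → a * b * c ≡ a * c * b
    swap = solve-∀

  ≐-+ : ∀ {q r X Y X′ Y′} → q ≐ X / Y → r ≐ X′ / Y′ → q ℚ.+ r ≐ X * Y′ + X′ * Y / Y * Y′
  ≐-+ {q@(mkℚ _ _ _)} {r@(mkℚ _ _ _)} {X} {Y} {X′} {Y′} (*≡* q≐X/Y) (*≡* r≐X′/Y′) =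
    ≐-rescale {{i*j≢0 Y Y′}} (≐-/ (↥ q * ↧ r + ↥ r * ↧ q) (↧ₙ q ℕ.* ↧ₙ r)) (begin
      (↥ q * ↧ r + ↥ r * ↧ q) * (Y * Y′)             ≡⟨ regroup (↥ q) (↧ r) (↥ r) (↧ q) Y Y′ ⟩
      (↥ q * Y) * (↧ r * Y′) + (↥ r * Y′) * (↧ q * Y) ≡⟨ cong₂ (λ u w → u * (↧ r * Y′) + w * (↧ q * Y)) q≐X/Y r≐X′/Y′ ⟩
      (X * ↧ q) * (↧ r * Y′) + (X′ * ↧ r) * (↧ q * Y) ≡⟨ collect X (↧ q) (↧ r) X′ Y Y′ ⟩
      (X * Y′ + X′ * Y) * (↧ q * ↧ r)                 ≡⟨ cong ((X * Y′ + X′ * Y) *_) (sym (pos-* (↧ₙ q) (↧ₙ r))) ⟩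
      (X * Y′ + X′ * Y) * + (↧ₙ q ℕ.* ↧ₙ r)           ∎)
    where
    open ≡-Reasoning
    regroup : ∀ a b c d y y′ → (a * b + c * d) * (y * y′) ≡ (a * y) * (b * y′) + (c * y′) * (d * y)
    regroup = solve-∀
    collect : ∀ x a b x′ y y′ → (x * a) * (b * y′) + (x′ * b) * (a * y) ≡ (x * y′ + x′ * y) * (a * b)
    collect = solve-∀

  ≐-* : ∀ {q r X Y X′ Y′} → q ≐ X / Y → r ≐ X′ / Y′ → q ℚ.* r ≐ X * X′ / Y * Y′
  ≐-* {q@(mkℚ _ _ _)} {r@(mkℚ _ _ _)} {X} {Y} {X′} {Y′} (*≡* q≐X/Y) (*≡* r≐X′/Y′) =
    ≐-rescale {{i*j≢0 Y Y′}} (≐-/ (↥ q * ↥ r) (↧ₙ q ℕ.* ↧ₙ r)) (begin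
      (↥ q * ↥ r) * (Y * Y′)       ≡⟨ interchange (↥ q) (↥ r) Y Y′ ⟩
      (↥ q * Y) * (↥ r * Y′)       ≡⟨ cong₂ _*_ q≐X/Y r≐X′/Y′ ⟩
      (X * ↧ q) * (X′ * ↧ r)       ≡⟨ interchange X (↧ q) X′ (↧ r) ⟩
      (X * X′) * (↧ q * ↧ r)       ≡⟨ cong ((X * X′) *_) (sym (pos-* (↧ₙ q) (↧ₙ r))) ⟩
      (X * X′) * + (↧ₙ q ℕ.* ↧ₙ r) ∎)
    where
    open ≡-Reasoning
    interchange : ∀ a b c d → (a * b) * (c * d) ≡ (a * c) * (b * d)
    interchange = solve-∀

  ≐-neg : ∀ {q X Y} → q ≐ X / Y → ℚ.- q ≐ - X / Y
  ≐-neg {q} {X} {Y} (*≡* q≐X/Y) = *≡* (begin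
    ↥ (ℚ.- q) * Y   ≡⟨ cong (_* Y) (ℚP.↥-neg q) ⟩
    - ↥ q * Y       ≡⟨ neg-distribˡ-* (↥ q) Y ⟨
    - (↥ q * Y)     ≡⟨ cong -_ q≐X/Y ⟩
    - (X * ↧ q)     ≡⟨ neg-distribˡ-* X (↧ q) ⟩
    - X * ↧ q       ≡⟨ cong (- X *_) (ℚP.↧-neg q) ⟨
    - X * ↧ (ℚ.- q) ∎)
    where open ≡-Reasoning

module Valuationℚ where
  open import Data.Nat.Base as ℕ using (zero; suc)
  import Data.Nat.Properties as ℕP
  import Data.Nat.Divisibility as ℕD
  open import Data.Nat.Coprimality as Coprimality using (Coprime; coprime-divisor)
  open import Data.Nat.Primality using (euclidsLemma; prime⇒nonTrivial)
  open import Data.Integer.Base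
  open import Data.Integer.Properties using (<-irrefl; <-asym; ∣i∣≡0⇒i≡0; abs-*; +-identityʳ; _≟_)
  open import Data.Integer.Divisibility.Signed using (_∣_; _∣?_; ∣ᵤ⇒∣; ∣⇒∣ᵤ)
  open import Data.Rational.Base as ℚ using (mkℚ; ↥_; ↧_; ↧ₙ_)
  import Data.Rational.Properties as ℚP
  open import Data.Product using (_×_; _,_)
  open import Data.Sum using (inj₁; inj₂)
  open import Function.Base using (_∘_)
  open import Function.Bundles using (_⇔_; mk⇔; Equivalence)
  open import Relation.Nullary using (¬_; contradiction; contraposition; yes; no)
  open import Relation.Binary.PropositionalEquality
  open Valuationℕ
  open PrimeDivisibility
  open Fraction

  private
    variable
      p m : ℕ
      q : ℚ
      X Y : ℤ
      x y : ℤ∞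

  <∞-irrefl : ¬ x <∞ x
  <∞-irrefl (fin<fin i<i) = <-irrefl refl i<i

  <∞-asym : x <∞ y → ¬ y <∞ x
  <∞-asym (fin<fin i<j) (fin<fin j<i) = <-asym i<j j<i

  coprime : ∀ q → Coprime ∣ ↥ q ∣ (↧ₙ q)
  coprime (mkℚ _ _ c) = Coprimality.recompute c

  ∤⇒≢0 : ¬ m ℕD.∣ ∣ X ∣ → X ≢ 0ℤ
  ∤⇒≢0 {m} m∤X refl = m∤X (m ℕD.∣0)

  ≢0⇒nonZero : ∀ X → X ≢ 0ℤ → ℕ.NonZero ∣ X ∣
  ≢0⇒nonZero X X≢0 = ℕ.≢-nonZero (X≢0 ∘ ∣i∣≡0⇒i≡0)

  v-≢0 : ∀ p q → ↥ q ≢ 0ℤ → v p q ≡ fin (+ vℕ p ∣ ↥ q ∣ - + vℕ p (↧ₙ q))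
  v-≢0 p (mkℚ n _ _) n≢0 with ∣ n ∣ in eq
  ... | zero  = contradiction (∣i∣≡0⇒i≡0 eq) n≢0
  ... | suc _ = refl

  ↥≡0⇒v≡∞ : ∀ q → ↥ q ≡ 0ℤ → v p q ≡ ∞
  ↥≡0⇒v≡∞ q ↥q≡0 rewrite ℚP.↥p≡0⇒p≡0 q ↥q≡0 = refl

  ∤↧⇒v≡vℕ↥ : ∀ q → ¬ p ℕD.∣ ↧ₙ q → ↥ q ≢ 0ℤ → v p q ≡ fin (+ vℕ p ∣ ↥ q ∣)
  ∤↧⇒v≡vℕ↥ {p} q p∤↧q ↥q≢0 = begin
    v p q                                    ≡⟨ v-≢0 p q ↥q≢0 ⟩
    fin (+ vℕ p ∣ ↥ q ∣ - + vℕ p (↧ₙ q))    ≡⟨ cong (λ k → fin (+ vℕ p ∣ ↥ q ∣ - + k)) (vℕ-∤ p∤↧q) ⟩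
    fin (+ vℕ p ∣ ↥ q ∣ + 0ℤ)               ≡⟨ cong fin (+-identityʳ _) ⟩
    fin (+ vℕ p ∣ ↥ q ∣)                    ∎
    where open ≡-Reasoning

  ∣↧⇒∤↥ : ∀ q → Prime p → p ℕD.∣ ↧ₙ q → ¬ p ℕD.∣ ∣ ↥ q ∣
  ∣↧⇒∤↥ q pr p∣↧q p∣↥q = ℕ.nonTrivial⇒≢1 {{prime⇒nonTrivial pr}} (coprime q (p∣↥q , p∣↧q))

  ∣↧⇒v<0 : ∀ q → Prime p → p ℕD.∣ ↧ₙ q → v p q <∞ fin 0ℤ
  ∣↧⇒v<0 {p} q pr p∣↧q = subst (_<∞ fin 0ℤ) (sym (v-≢0 p q ↥q≢0)) (fin<fin
    (subst (λ k → + k - + vℕ p (↧ₙ q) < 0ℤ) (sym (vℕ-∤ {{≢0⇒nonZero (↥ q) ↥q≢0}} p∤↥q)) (0-b<0 (vℕ-∣ p∣↧q))))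
    where
    p∤↥q = ∣↧⇒∤↥ q pr p∣↧q
    ↥q≢0 = ∤⇒≢0 p∤↥q
    0-b<0 : ∀ {b} → 1 ℕ.≤ b → + 0 - + b < 0ℤ
    0-b<0 {suc _} _ = -<+

  ∤↧⇒v≮0 : ∀ q → ¬ p ℕD.∣ ↧ₙ q → ¬ v p q <∞ fin 0ℤ
  ∤↧⇒v≮0 q p∤↧q with ↥ q ≟ 0ℤ
  ... | yes ↥q≡0 = subst (λ w → ¬ w <∞ fin 0ℤ) (sym (↥≡0⇒v≡∞ q ↥q≡0)) λ ()
  ... | no  ↥q≢0 = subst (λ w → ¬ w <∞ fin 0ℤ) (sym (∤↧⇒v≡vℕ↥ q p∤↧q ↥q≢0)) λ { (fin<fin (+<+ ())) }

  v<0⇒∣↧ : ∀ q → v p q <∞ fin 0ℤ → p ℕD.∣ ↧ₙ q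
  v<0⇒∣↧ {p} q v<0 with p ℕD.∣? ↧ₙ q
  ... | yes p∣↧q = p∣↧q
  ... | no  p∤↧q = contradiction v<0 (∤↧⇒v≮0 q p∤↧q)

  ≐-abs : q ≐ X / Y → ∣ ↥ q ∣ ℕ.* ∣ Y ∣ ≡ ∣ X ∣ ℕ.* ↧ₙ q
  ≐-abs {q} {X} {Y} (*≡* q≐X/Y) = trans (sym (abs-* (↥ q) Y)) (trans (cong ∣_∣ q≐X/Y) (abs-* X (↧ q)))

  ↧∣ : q ≐ X / Y → ↧ₙ q ℕD.∣ ∣ Y ∣
  ↧∣ {q} {X} q≐X/Y = coprime-divisor (Coprimality.sym (coprime q))
    (subst (ℕD._∣_ (↧ₙ q)) (sym (≐-abs q≐X/Y)) (ℕD.n∣m*n ∣ X ∣))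

  ≐-∣⇔ : q ≐ X / Y → Coprime m ∣ Y ∣ → m ℕD.∣ ∣ ↥ q ∣ ⇔ m ℕD.∣ ∣ X ∣
  ≐-∣⇔ {q} {X} {Y} {m} q≐X/Y m⊥Y = mk⇔
    (λ m∣↥q → coprime-divisor (coprime-∣ʳ m⊥Y (↧∣ q≐X/Y))
      (subst (m ℕD.∣_) (trans (≐-abs q≐X/Y) (ℕP.*-comm ∣ X ∣ (↧ₙ q))) (ℕD.∣m⇒∣m*n ∣ Y ∣ m∣↥q)))
    (λ m∣X → coprime-divisor m⊥Y
      (subst (m ℕD.∣_) (trans (sym (≐-abs q≐X/Y)) (ℕP.*-comm ∣ ↥ q ∣ ∣ Y ∣)) (ℕD.∣m⇒∣m*n (↧ₙ q) m∣X)))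

  ∣Y⇒v<0 : Prime p → q ≐ X / Y → + p ∣ Y → ¬ + p ∣ X → v p q <∞ fin 0ℤ
  ∣Y⇒v<0 {p} {q} {X} pr q≐X/Y p∣Y p∤X
    with euclidsLemma ∣ X ∣ (↧ₙ q) pr (subst (p ℕD.∣_) (≐-abs q≐X/Y) (ℕD.∣n⇒∣m*n ∣ ↥ q ∣ (∣⇒∣ᵤ p∣Y)))
  ... | inj₁ p∣X  = contradiction (∣ᵤ⇒∣ p∣X) p∤X
  ... | inj₂ p∣↧q = ∣↧⇒v<0 q pr p∣↧q

  v<0⇒∣Y : q ≐ X / Y → v p q <∞ fin 0ℤ → + p ∣ Y
  v<0⇒∣Y {q} q≐X/Y v<0 = ∣ᵤ⇒∣ (ℕD.∣-trans (v<0⇒∣↧ q v<0) (↧∣ q≐X/Y))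

  module _ {p q X Y} (pr : Prime p) (q≐X/Y : q ≐ X / Y) (p∤Y : ¬ + p ∣ Y) where
    private
      transfer : Coprime m ∣ Y ∣ → m ℕD.∣ ∣ ↥ q ∣ ⇔ + m ∣ X
      transfer m⊥Y = mk⇔ (∣ᵤ⇒∣ ∘ Equivalence.to (≐-∣⇔ q≐X/Y m⊥Y)) (Equivalence.from (≐-∣⇔ q≐X/Y m⊥Y) ∘ ∣⇒∣ᵤ)

      p⊥Y : Coprime p ∣ Y ∣
      p⊥Y = prime∤⇒coprime pr (p∤Y ∘ ∣ᵤ⇒∣)

      p²⊥Y = coprime-*ˡ p⊥Y p⊥Y
      p³⊥Y = coprime-*ˡ p⊥Y p²⊥Y

      ↥q≢0 : Coprime m ∣ Y ∣ → ¬ + m ∣ X → ↥ q ≢ 0ℤ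
      ↥q≢0 m⊥Y m∤X = ∤⇒≢0 (m∤X ∘ Equivalence.to (transfer m⊥Y))

      v≡vℕ↥ : ↥ q ≢ 0ℤ → v p q ≡ fin (+ vℕ p ∣ ↥ q ∣)
      v≡vℕ↥ = ∤↧⇒v≡vℕ↥ q (λ p∣↧q → p∤Y (∣ᵤ⇒∣ (ℕD.∣-trans p∣↧q (↧∣ q≐X/Y))))

    ∣X⇒0<v : + p ∣ X → fin 0ℤ <∞ v p q
    ∣X⇒0<v p∣X with ↥ q ≟ 0ℤ
    ... | yes ↥q≡0 = subst (fin 0ℤ <∞_) (sym (↥≡0⇒v≡∞ q ↥q≡0)) fin<∞
    ... | no  ↥q≢0 = subst (fin 0ℤ <∞_) (sym (v≡vℕ↥ ↥q≢0))
      (fin<fin (+<+ (vℕ-∣ {{≢0⇒nonZero (↥ q) ↥q≢0}} (Equivalence.from (transfer p⊥Y) p∣X))))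

    ∤X⇒v≡0 : ¬ + p ∣ X → v p q ≡ fin 0ℤ
    ∤X⇒v≡0 p∤X = trans (v≡vℕ↥ ↥q≢0′) (cong (λ k → fin (+ k))
      (vℕ-∤ {{≢0⇒nonZero (↥ q) ↥q≢0′}} (contraposition (Equivalence.to (transfer p⊥Y)) p∤X)))
      where ↥q≢0′ = ↥q≢0 p⊥Y p∤X

    p∥X⇒v≡1 : + p ∣ X → ¬ + (p ℕ.* p) ∣ X → v p q ≡ fin (+ 1)
    p∥X⇒v≡1 p∣X p²∤X = trans (v≡vℕ↥ ↥q≢0′) (cong (λ k → fin (+ k))
      (vℕ-∥ {{≢0⇒nonZero (↥ q) ↥q≢0′}} (Equivalence.from (transfer p⊥Y) p∣X)
                                        (contraposition (Equivalence.to (transfer p²⊥Y)) p²∤X)))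
      where ↥q≢0′ = ↥q≢0 p²⊥Y p²∤X

    p²∥X⇒v≡2 : + (p ℕ.* p) ∣ X → ¬ + (p ℕ.* (p ℕ.* p)) ∣ X → v p q ≡ fin (+ 2)
    p²∥X⇒v≡2 p²∣X p³∤X = trans (v≡vℕ↥ ↥q≢0′) (cong (λ k → fin (+ k))
      (vℕ-∥² {{≢0⇒nonZero (↥ q) ↥q≢0′}} {{prime⇒nonTrivial pr}} (Equivalence.from (transfer p²⊥Y) p²∣X)
                                                                 (contraposition (Equivalence.to (transfer p³⊥Y)) p³∤X)))
      where ↥q≢0′ = ↥q≢0 p³⊥Y p³∤X

    0<v⇒∣X : fin 0ℤ <∞ v p q → + p ∣ X
    0<v⇒∣X 0<v with + p ∣? X
    ... | yes p∣X = p∣X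
    ... | no  p∤X = contradiction (subst (fin 0ℤ <∞_) (∤X⇒v≡0 p∤X) 0<v) <∞-irrefl

  v≮0⇒∤↧ : ∀ q → Prime p → ¬ v p q <∞ fin 0ℤ → ¬ + p ∣ ↧ q
  v≮0⇒∤↧ q pr v≮0 p∣↧q = v≮0 (∣↧⇒v<0 q pr (∣⇒∣ᵤ p∣↧q))

  0<v⇒∤↧×∣↥ : ∀ q → Prime p → fin 0ℤ <∞ v p q → ¬ + p ∣ ↧ q × + p ∣ ↥ q
  0<v⇒∤↧×∣↥ q pr 0<v = p∤↧q , 0<v⇒∣X pr (≐-refl q) p∤↧q 0<v
    where p∤↧q = v≮0⇒∤↧ q pr (<∞-asym 0<v)

  v≡0⇒∤↧×∤↥ : ∀ q → Prime p → v p q ≡ fin 0ℤ → ¬ + p ∣ ↧ q × ¬ + p ∣ ↥ q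
  v≡0⇒∤↧×∤↥ q pr v≡0 = p∤↧q , λ p∣↥q → <∞-irrefl (subst (fin 0ℤ <∞_) v≡0 (∣X⇒0<v pr (≐-refl q) p∤↧q p∣↥q))
    where p∤↧q = v≮0⇒∤↧ q pr (λ v<0 → <∞-irrefl (subst (_<∞ fin 0ℤ) v≡0 v<0))

  v≡1⇒∤↧×p∥↥ : ∀ q → Prime p → v p q ≡ fin (+ 1) → ¬ + p ∣ ↧ q × + p ∣ ↥ q × ¬ + (p ℕ.* p) ∣ ↥ q
  v≡1⇒∤↧×p∥↥ {p} q pr v≡1 with 0<v⇒∤↧×∣↥ q pr (subst (fin 0ℤ <∞_) (sym v≡1) (fin<fin (+<+ (ℕ.s≤s ℕ.z≤n))))
  ... | p∤↧q , p∣↥q = p∤↧q , p∣↥q , p²∤↥q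
    where
    ↥q≢0 : ↥ q ≢ 0ℤ
    ↥q≢0 ↥q≡0 with () ← trans (sym (↥≡0⇒v≡∞ q ↥q≡0)) v≡1
    p²∤↥q : ¬ + (p ℕ.* p) ∣ ↥ q
    p²∤↥q p²∣↥q
      with vℕ p ∣ ↥ q ∣ | trans (sym (∤↧⇒v≡vℕ↥ q (p∤↧q ∘ ∣ᵤ⇒∣) ↥q≢0)) v≡1
         | vℕ-∣² {{≢0⇒nonZero (↥ q) ↥q≢0}} {{prime⇒nonTrivial pr}} (∣⇒∣ᵤ p²∣↥q)
    ... | _ | refl | ℕ.s≤s ()

-- For a = N / D this is yₙ = fⁿ(0) - a = A n / Y n (see Orbit.orbit≐), and B n / Y n = yₙ + 1,
-- C n / Y n = yₙ + 2a.
module Recurrence (N D : ℤ) where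
  open import Data.Nat.Base as ℕ using (zero; suc; _<_)
  import Data.Nat.Properties as ℕP
  import Data.Nat.Divisibility as ℕD
  open import Data.Nat.Primality using (prime⇒nonTrivial)
  open import Data.Integer.Base using (+_; -_; _+_; _-_; _*_; 1ℤ)
  open import Data.Integer.Properties using (neg-involutive)
  open import Data.Integer.Divisibility.Signed
  open import Data.Integer.Tactic.RingSolver using (solve-∀)
  open import Data.Product using (_×_; _,_; proj₁; proj₂)
  open import Data.Sum using (_⊎_; inj₁; inj₂; [_,_]′)
  open import Relation.Nullary using (¬_; contradiction)
  open import Relation.Binary.PropositionalEquality
  open PrimeDivisibility using (euclidsLemmaℤ)

  g : ℕ → ℤ
  g zero    = 1ℤ
  g (suc n) = g n * g n * D

  Y : ℕ → ℤ
  Y n = D * g n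

  A : ℕ → ℤ
  A zero    = - N
  A (suc n) = A n * (A n + + 2 * N * g n) - Y n * Y n

  B : ℕ → ℤ
  B n = A n + Y n

  C : ℕ → ℤ
  C n = A n + + 2 * N * g n

  B-suc : ∀ n → B (suc n) ≡ A n * C n
  B-suc n = identity (A n) N D (g n)
    where
    identity : ∀ a N D g → a * (a + + 2 * N * g) - D * g * (D * g) + D * (g * g * D) ≡ a * (a + + 2 * N * g)
    identity = solve-∀

  C-suc : ∀ n → C (suc n) ≡ B n * (C n - Y n)
  C-suc n = identity (A n) N D (g n)
    where
    identity : ∀ a N D g → a * (a + + 2 * N * g) - D * g * (D * g) + + 2 * N * (g * g * D)
                         ≡ (a + D * g) * ((a + + 2 * N * g) - D * g)
    identity = solve-∀

  C-zero : C 0 ≡ N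
  C-zero = identity N
    where
    identity : ∀ N → - N + + 2 * N * 1ℤ ≡ N
    identity = solve-∀

  ∣A⇒∣B⊎∣C : ∀ {d m} → d ∣ A m → ∀ j → d ∣ B (suc j ℕ.+ m) ⊎ d ∣ C (suc j ℕ.+ m)
  ∣A⇒∣B⊎∣C {d} {m} d∣A zero = inj₁ (subst (d ∣_) (sym (B-suc m)) (∣m⇒∣m*n (C m) d∣A))
  ∣A⇒∣B⊎∣C {d} {m} d∣A (suc j) with ∣A⇒∣B⊎∣C d∣A j
  ... | inj₁ d∣B = inj₂ (subst (d ∣_) (sym (C-suc n)) (∣m⇒∣m*n (C n - Y n) d∣B))
    where n = suc j ℕ.+ m
  ... | inj₂ d∣C = inj₁ (subst (d ∣_) (sym (B-suc n)) (∣n⇒∣m*n (A n) d∣C))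
    where n = suc j ℕ.+ m

  module _ {p} (pr : Prime p) where

    ∤D⇒∤g : ¬ + p ∣ D → ∀ n → ¬ + p ∣ g n
    ∤D⇒∤g p∤D zero    p∣1 = ℕ.nonTrivial⇒≢1 {{prime⇒nonTrivial pr}} (ℕD.∣1⇒≡1 (∣⇒∣ᵤ p∣1))
    ∤D⇒∤g p∤D (suc n) p∣g with euclidsLemmaℤ pr (g n * g n) D p∣g
    ... | inj₁ p∣gg = [ ∤D⇒∤g p∤D n , ∤D⇒∤g p∤D n ]′ (euclidsLemmaℤ pr (g n) (g n) p∣gg)
    ... | inj₂ p∣D  = p∤D p∣D

    ∤D⇒∤Y : ¬ + p ∣ D → ∀ n → ¬ + p ∣ Y n
    ∤D⇒∤Y p∤D n p∣Y = [ p∤D , ∤D⇒∤g p∤D n ]′ (euclidsLemmaℤ pr D (g n) p∣Y)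

    ∣D⇒∤A×∤C : + p ∣ D → ¬ + p ∣ N → ∀ n → ¬ + p ∣ A n × ¬ + p ∣ C n
    ∣D⇒∤A×∤C p∣D p∤N zero = p∤A₀ , p∤C₀
      where
      p∤A₀ = λ p∣-N → p∤N (subst (+ p ∣_) (neg-involutive N) (∣m⇒∣-m p∣-N))
      p∤C₀ = λ p∣C₀ → p∤N (subst (+ p ∣_) C-zero p∣C₀)
    ∣D⇒∤A×∤C p∣D p∤N (suc n) with ∣D⇒∤A×∤C p∣D p∤N n
    ... | p∤Aₙ , p∤Cₙ = p∤A , p∤C
      where
      p∣Y : ∀ n → + p ∣ Y n
      p∣Y n = ∣m⇒∣m*n (g n) p∣D
      ∣A⇒∣B : ∀ n → + p ∣ A n → + p ∣ B n
      ∣A⇒∣B n p∣A = ∣m∣n⇒∣m+n p∣A (p∣Y n)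
      p∤AC : ¬ + p ∣ A n * C n
      p∤AC p∣AC = [ p∤Aₙ , p∤Cₙ ]′ (euclidsLemmaℤ pr (A n) (C n) p∣AC)
      p∤A : ¬ + p ∣ A (suc n)
      p∤A p∣A = p∤AC (subst (+ p ∣_) (B-suc n) (∣A⇒∣B (suc n) p∣A))
      p∤C : ¬ + p ∣ C (suc n)
      p∤C p∣C = [ (λ p∣B → p∤Aₙ (∣m+n∣n⇒∣m p∣B (p∣Y n))) , (λ p∣C-Y → p∤Cₙ (∣m+n∣n⇒∣m p∣C-Y (∣m⇒∣-m (p∣Y n)))) ]′
        (euclidsLemmaℤ pr (B n) (C n - Y n) (subst (+ p ∣_) (C-suc n) p∣C))

    ∣A-twice⇒∣2N : ¬ + p ∣ D → ∀ {m n} → m < n → + p ∣ A m → + p ∣ A n → + p ∣ + 2 * N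
    ∣A-twice⇒∣2N p∤D {m} {n} m<n p∣Aₘ p∣Aₙ = [ (λ p∣B → contradiction p∣B p∤B) , ∣C⇒∣2N ]′ (∣A⇒∣B⊎∣C p∣Aₘ j)
      where
      j = proj₁ (ℕP.m≤n⇒∃[o]m+o≡n m<n)
      k = suc j ℕ.+ m
      k≡n : k ≡ n
      k≡n = trans (cong suc (ℕP.+-comm j m)) (proj₂ (ℕP.m≤n⇒∃[o]m+o≡n m<n))
      p∣Aₖ : + p ∣ A k
      p∣Aₖ = subst (λ i → + p ∣ A i) (sym k≡n) p∣Aₙ
      p∤B : ¬ + p ∣ B k
      p∤B p∣B = ∤D⇒∤Y p∤D k (∣m+n∣m⇒∣n p∣B p∣Aₖ)
      ∣C⇒∣2N : + p ∣ C k → + p ∣ + 2 * N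
      ∣C⇒∣2N p∣C = [ (λ p∣2N → p∣2N) , (λ p∣g → contradiction p∣g (∤D⇒∤g p∤D k)) ]′
        (euclidsLemmaℤ pr (+ 2 * N) (g k) (∣m+n∣m⇒∣n p∣C p∣Aₖ))

module Congruence where
  open import Data.Nat.Base as ℕ using (suc)
  open import Data.Integer.Base using (+_; -_; _+_; _-_; _*_; 0ℤ; 1ℤ)
  open import Data.Integer.Properties using (*-comm)
  open import Data.Integer.DivMod using (_%_; _/_; n%d<d; a≡a%n+[a/n]*n)
  open import Data.Integer.Divisibility.Signed
  open import Data.Integer.Tactic.RingSolver using (solve-∀)
  open import Data.Product using (∃-syntax; _×_; _,_)
  open import Data.Sum using (_⊎_; inj₁; inj₂)
  open import Relation.Nullary using (¬_; contradiction)
  open import Relation.Nullary.Decidable using (from-no)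
  open import Relation.Binary.PropositionalEquality

  infix 4 _≡_[mod_]
  _≡_[mod_] : ℤ → ℤ → ℤ → Set
  x ≡ r [mod m ] = ∃[ k ] x ≡ r + m * k

  private
    variable
      x r m d : ℤ

  parity : ∀ x → x ≡ 0ℤ [mod + 2 ] ⊎ x ≡ 1ℤ [mod + 2 ]
  parity x with x % + 2 | n%d<d x (+ 2) | a≡a%n+[a/n]*n x (+ 2)
  ... | 0 | _ | x≡ = inj₁ (x / + 2 , trans x≡ (cong (λ z → 0ℤ + z) (*-comm (x / + 2) (+ 2))))
  ... | 1 | _ | x≡ = inj₂ (x / + 2 , trans x≡ (cong (λ z → 1ℤ + z) (*-comm (x / + 2) (+ 2))))
  ... | suc (suc _) | ℕ.s≤s (ℕ.s≤s ()) | _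

  odd² : x ≡ 1ℤ [mod + 2 ] → x * x ≡ 1ℤ [mod + 8 ]
  odd² (s , refl) with parity s
  ... | inj₁ (t , refl) = t * (1ℤ + + 2 * t) , identity t
    where
    identity : ∀ t → (1ℤ + + 2 * (0ℤ + + 2 * t)) * (1ℤ + + 2 * (0ℤ + + 2 * t)) ≡ 1ℤ + + 8 * (t * (1ℤ + + 2 * t))
    identity = solve-∀
  ... | inj₂ (t , refl) = (1ℤ + + 2 * t) * (1ℤ + t) , identity t
    where
    identity : ∀ t → (1ℤ + + 2 * (1ℤ + + 2 * t)) * (1ℤ + + 2 * (1ℤ + + 2 * t)) ≡ 1ℤ + + 8 * ((1ℤ + + 2 * t) * (1ℤ + t))
    identity = solve-∀

  mod-∣ : x ≡ r [mod m ] → d ∣ m → d ∣ r → d ∣ x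
  mod-∣ (k , refl) d∣m d∣r = ∣m∣n⇒∣m+n d∣r (∣m⇒∣m*n k d∣m)

  mod-∤ : x ≡ r [mod m ] → d ∣ m → ¬ d ∣ r → ¬ d ∣ x
  mod-∤ (k , refl) d∣m d∤r d∣x = d∤r (∣m+n∣n⇒∣m d∣x (∣m⇒∣m*n k d∣m))

  even⇒∣ : x ≡ 0ℤ [mod + 2 ] → + 2 ∣ x
  even⇒∣ x≡0 = mod-∣ x≡0 ∣-refl (divides 0ℤ refl)

  odd⇒∤ : x ≡ 1ℤ [mod + 2 ] → ¬ + 2 ∣ x
  odd⇒∤ x≡1 = mod-∤ x≡1 ∣-refl (from-no (+ 2 ∣? 1ℤ))

  ≡2[mod4]⇒ : x ≡ + 2 [mod + 4 ] → + 2 ∣ x × ¬ + 4 ∣ x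
  ≡2[mod4]⇒ x≡2 = mod-∣ x≡2 (divides (+ 2) refl) ∣-refl , mod-∤ x≡2 ∣-refl (from-no (+ 4 ∣? + 2))

  ≡4[mod8]⇒ : x ≡ + 4 [mod + 8 ] → + 4 ∣ x × ¬ + 8 ∣ x
  ≡4[mod8]⇒ x≡4 = mod-∣ x≡4 (divides (+ 2) refl) ∣-refl , mod-∤ x≡4 ∣-refl (from-no (+ 8 ∣? + 4))

  ∣⇒even : + 2 ∣ x → x ≡ 0ℤ [mod + 2 ]
  ∣⇒even (divides k refl) = k , identity k
    where
    identity : ∀ k → k * + 2 ≡ 0ℤ + + 2 * k
    identity = solve-∀

  ∤⇒odd : ¬ + 2 ∣ x → x ≡ 1ℤ [mod + 2 ]
  ∤⇒odd {x} 2∤x with parity x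
  ... | inj₁ x≡0 = contradiction (even⇒∣ x≡0) 2∤x
  ... | inj₂ x≡1 = x≡1

  ∣∤⇒≡2[mod4] : + 2 ∣ x → ¬ + 4 ∣ x → x ≡ + 2 [mod + 4 ]
  ∣∤⇒≡2[mod4] (divides k refl) 4∤x with parity k
  ... | inj₁ (t , refl) = contradiction (divides t (identity t)) 4∤x
    where
    identity : ∀ t → (0ℤ + + 2 * t) * + 2 ≡ t * + 4
    identity = solve-∀
  ... | inj₂ (t , refl) = t , identity t
    where
    identity : ∀ t → (1ℤ + + 2 * t) * + 2 ≡ + 2 + + 4 * t
    identity = solve-∀

  neg-even : x ≡ 0ℤ [mod + 2 ] → - x ≡ 0ℤ [mod + 2 ]
  neg-even (k , refl) = - k , identity k
    where
    identity : ∀ k → - (0ℤ + + 2 * k) ≡ 0ℤ + + 2 * - k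
    identity = solve-∀

  neg-odd : x ≡ 1ℤ [mod + 2 ] → - x ≡ 1ℤ [mod + 2 ]
  neg-odd (k , refl) = - k - 1ℤ , identity k
    where
    identity : ∀ k → - (1ℤ + + 2 * k) ≡ 1ℤ + + 2 * (- k - 1ℤ)
    identity = solve-∀

  -- The recursion of Recurrence.A, with a = A n, g = g n and y = Y n.
  module _ {a N g y : ℤ} where
    step-even : a ≡ 0ℤ [mod + 2 ] → y ≡ 1ℤ [mod + 2 ] → a * (a + + 2 * N * g) - y * y ≡ 1ℤ [mod + 2 ]
    step-even (s , refl) (t , refl) = + 2 * s * (s + N * g) - 1ℤ - + 2 * t * (1ℤ + t) , identity s N g t
      where
      identity : ∀ s N g t → (0ℤ + + 2 * s) * ((0ℤ + + 2 * s) + + 2 * N * g) - (1ℤ + + 2 * t) * (1ℤ + + 2 * t)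
                           ≡ 1ℤ + + 2 * (+ 2 * s * (s + N * g) - 1ℤ - + 2 * t * (1ℤ + t))
      identity = solve-∀

    step-odd-N-even : a ≡ 1ℤ [mod + 2 ] → N ≡ 0ℤ [mod + 2 ] → y ≡ 1ℤ [mod + 2 ] →
                      a * (a + + 2 * N * g) - y * y ≡ 0ℤ [mod + 2 ]
    step-odd-N-even (s , refl) (u , refl) (t , refl) =
      + 2 * (s + s * s - t - t * t) + + 2 * u * g * (1ℤ + + 2 * s) , identity s u g t
      where
      identity : ∀ s u g t → (1ℤ + + 2 * s) * ((1ℤ + + 2 * s) + + 2 * (0ℤ + + 2 * u) * g) - (1ℤ + + 2 * t) * (1ℤ + + 2 * t)
                           ≡ 0ℤ + + 2 * (+ 2 * (s + s * s - t - t * t) + + 2 * u * g * (1ℤ + + 2 * s))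
      identity = solve-∀

    step-odd-N-odd : a ≡ 1ℤ [mod + 2 ] → N ≡ 1ℤ [mod + 2 ] → g ≡ 1ℤ [mod + 2 ] → y ≡ 1ℤ [mod + 2 ] →
                     a * (a + + 2 * N * g) - y * y ≡ + 2 [mod + 4 ]
    step-odd-N-odd (s , refl) (u , refl) (w , refl) (t , refl) = s + s * s - t - t * t + c , identity s u w t
      where
      -- (1 + 2u) (1 + 2w) (1 + 2s) = 1 + 2c
      c = u + w + s + + 2 * (u * w + u * s + w * s) + + 4 * u * w * s
      identity : ∀ s u w t →
        (1ℤ + + 2 * s) * ((1ℤ + + 2 * s) + + 2 * (1ℤ + + 2 * u) * (1ℤ + + 2 * w)) - (1ℤ + + 2 * t) * (1ℤ + + 2 * t)
        ≡ + 2 + + 4 * (s + s * s - t - t * t + (u + w + s + + 2 * (u * w + u * s + w * s) + + 4 * u * w * s))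
      identity = solve-∀

    step-odd-N≡2 : a ≡ 1ℤ [mod + 2 ] → N ≡ + 2 [mod + 4 ] → g ≡ 1ℤ [mod + 2 ] → y ≡ 1ℤ [mod + 2 ] →
                   a * (a + + 2 * N * g) - y * y ≡ + 4 [mod + 8 ]
    step-odd-N≡2 a≡1@(s , refl) (u , refl) (w , refl) y≡1 with odd² a≡1 | odd² y≡1
    ... | k₁ , a²≡ | k₂ , y²≡ = k₁ - k₂ + c , (begin
      a * (a + + 2 * N * g) - y * y                       ≡⟨ expand a N g y ⟩
      a * a + + 2 * N * g * a - y * y                     ≡⟨ cong₂ (λ a² y² → a² + + 2 * N * g * a - y²) a²≡ y²≡ ⟩
      (1ℤ + + 8 * k₁) + + 2 * N * g * a - (1ℤ + + 8 * k₂) ≡⟨ collect k₁ k₂ s u w ⟩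
      + 4 + + 8 * (k₁ - k₂ + c)                           ∎)
      where
      open ≡-Reasoning
      c = u + w + s + + 2 * (u * w + u * s + w * s) + + 4 * u * w * s
      expand : ∀ a N g y → a * (a + + 2 * N * g) - y * y ≡ a * a + + 2 * N * g * a - y * y
      expand = solve-∀
      collect : ∀ k₁ k₂ s u w → (1ℤ + + 8 * k₁) + + 2 * (+ 2 + + 4 * u) * (1ℤ + + 2 * w) * (1ℤ + + 2 * s) - (1ℤ + + 8 * k₂)
                              ≡ + 4 + + 8 * (k₁ - k₂ + (u + w + s + + 2 * (u * w + u * s + w * s) + + 4 * u * w * s))
      collect = solve-∀

module Orbit (a : ℚ) where
  open import Data.Nat.Base using (zero; suc)
  open import Data.Integer.Base using (+_; -_; _+_; _-_; _*_; 1ℤ; NonZero)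
  open import Data.Integer.Properties using (i*j≢0)
  open import Data.Integer.Tactic.RingSolver using (solve-∀)
  open import Data.Rational.Base as ℚ using (↥_; ↧_; 0ℚ; 1ℚ)
  import Data.Rational.Properties as ℚP
  open import Data.Rational.Solver using (module +-*-Solver)
  open import Relation.Binary.PropositionalEquality
  open Fraction
  open Recurrence (↥ a) (↧ a) public

  private
    N = ↥ a
    D = ↧ a

  g-nonZero : ∀ n → NonZero (g n)
  g-nonZero zero    = _
  g-nonZero (suc n) = i*j≢0 (g n * g n) D {{i*j≢0 (g n) (g n) {{g-nonZero n}} {{g-nonZero n}}}}

  Y-nonZero : ∀ n → NonZero (Y n)
  Y-nonZero n = i*j≢0 D (g n) {{_}} {{g-nonZero n}}

  orbitDiff-suc : ∀ n → orbitDiff a (suc n) ≡ orbitDiff a n ℚ.* (orbitDiff a n ℚ.+ (a ℚ.+ a)) ℚ.- 1ℚ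
  orbitDiff-suc n = identity (iter (fMap a) n 0ℚ) a
    where
    open +-*-Solver
    identity : ∀ x a → (x ℚ.* x ℚ.+ ((ℚ.- 1ℚ ℚ.+ a) ℚ.- a ℚ.* a)) ℚ.- a
                     ≡ (x ℚ.- a) ℚ.* ((x ℚ.- a) ℚ.+ (a ℚ.+ a)) ℚ.- 1ℚ
    identity = solve 2 (λ x a → (x :* x :+ ((:- con 1ℚ :+ a) :- a :* a)) :- a
                            := (x :- a) :* ((x :- a) :+ (a :+ a)) :- con 1ℚ) refl

  orbit≐ : ∀ n → orbitDiff a n ≐ A n / Y n
  orbit≐ zero = subst (_≐ - N / Y 0) (sym (ℚP.+-identityˡ (ℚ.- a))) -a≐
    where
    -a≐ : ℚ.- a ≐ - N / Y 0
    -a≐ = ≐-rescale {{Y-nonZero 0}} (≐-neg (≐-refl a)) (identity N D)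
      where
      identity : ∀ N D → - N * (D * 1ℤ) ≡ - N * D
      identity = solve-∀
  orbit≐ (suc n) = subst (_≐ A (suc n) / Y (suc n)) (sym (orbitDiff-suc n)) yₙ₊₁≐
    where
    yₙ≐ = orbit≐ n
    yₙ₊₁≐ : orbitDiff a n ℚ.* (orbitDiff a n ℚ.+ (a ℚ.+ a)) ℚ.- 1ℚ ≐ A (suc n) / Y (suc n)
    yₙ₊₁≐ = ≐-rescale {{Y-nonZero (suc n)}}
      (≐-+ (≐-* yₙ≐ (≐-+ yₙ≐ (≐-+ (≐-refl a) (≐-refl a)))) (≐-neg (≐-refl 1ℚ)))
      (identity (A n) N D (g n))
      where
      identity : ∀ A N D g → (A * (A * (D * D) + (N * D + N * D) * (D * g)) * + 1 + - + 1 * (D * g * (D * g * (D * D))))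
                               * (D * (g * g * D))
                           ≡ (A * (A + + 2 * N * g) - D * g * (D * g)) * (D * g * (D * g * (D * D)) * + 1)
      identity = solve-∀

module Alternation where
  open import Data.Nat.Base
  open import Data.Nat.Divisibility
  open import Data.Product using (_×_; _,_; proj₁; proj₂)
  open import Relation.Nullary using (contradiction)
  open import Data.Nat.Properties using (+-comm)
  open import Relation.Binary.PropositionalEquality using (subst)

  ∣suc⇒∤ : ∀ {n} → 2 ∣ suc n → 2 ∤ n
  ∣suc⇒∤ {n} 2∣1+n 2∣n with () ← ∣1⇒≡1 (∣m+n∣m⇒∣n (subst (2 ∣_) (+-comm 1 n) 2∣1+n) 2∣n)

  alternating : ∀ {P Q : ℕ → Set} → P 0 → (∀ {n} → P n → Q (suc n)) → (∀ {n} → Q n → P (suc n)) →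
                (∀ n → 2 ∣ n → P n) × (∀ n → 2 ∤ n → Q n)
  alternating {P} {Q} P₀ P⇒Q Q⇒P = (λ n → proj₁ (by-parity n)) , (λ n → proj₂ (by-parity n))
    where
    by-parity : ∀ n → (2 ∣ n → P n) × (2 ∤ n → Q n)
    by-parity 0 = (λ _ → P₀) , (λ 2∤0 → contradiction (2 ∣0) 2∤0)
    by-parity 1 = (λ 2∣1 → contradiction (2 ∣0) (∣suc⇒∤ 2∣1)) , (λ _ → P⇒Q P₀)
    by-parity (suc (suc n)) =
      (λ 2∣2+n → Q⇒P (P⇒Q (proj₁ (by-parity n) (∣m+n∣m⇒∣n 2∣2+n ∣-refl)))) ,
      (λ 2∤2+n → P⇒Q (Q⇒P (proj₂ (by-parity n) (λ 2∣n → 2∤2+n (∣m∣n⇒∣m+n ∣-refl 2∣n)))))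

module PAdicOrbit (a : ℚ) {p : ℕ} (pr : Prime p) where
  import Data.Nat.Properties as ℕP
  open import Data.Integer.Base using (+_; _+_; _*_; 0ℤ)
  open import Data.Integer.Divisibility.Signed using (_∣_; _∣?_; ∣⇒∣ᵤ; ∣m⇒∣m*n)
  open import Data.Integer.Tactic.RingSolver using (solve-∀)
  open import Data.Rational.Base as ℚ using (↥_; ↧_)
  open import Data.Product using (proj₁)
  open import Data.Sum using ([_,_]′)
  open import Relation.Nullary using (¬_; contradiction; yes; no)
  open import Relation.Binary.Definitions using (tri<; tri≈; tri>)
  open import Relation.Binary.PropositionalEquality
  open PrimeDivisibility using (euclidsLemmaℤ)
  open Fraction
  open Valuationℚ
  open Orbit a

  private
    N = ↥ a
    D = ↧ a

  v<0⇒v-orbit<0 : v p a <∞ fin 0ℤ → ∀ n → v p (orbitDiff a n) <∞ fin 0ℤ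
  v<0⇒v-orbit<0 v<0 n = ∣Y⇒v<0 pr (orbit≐ n) (∣m⇒∣m*n (g n) p∣D) (proj₁ (∣D⇒∤A×∤C pr p∣D p∤N n))
    where
    p∣D = v<0⇒∣Y (≐-refl a) v<0
    p∤N = λ p∣N → ∣↧⇒∤↥ a pr (∣⇒∣ᵤ p∣D) (∣⇒∣ᵤ p∣N)

  v-orbit<0⇒v<0 : ∀ n → v p (orbitDiff a n) <∞ fin 0ℤ → v p a <∞ fin 0ℤ
  v-orbit<0⇒v<0 n v<0 with + p ∣? D
  ... | yes p∣D = ∣↧⇒v<0 a pr (∣⇒∣ᵤ p∣D)
  ... | no  p∤D = contradiction (v<0⇒∣Y (orbit≐ n) v<0) (∤D⇒∤Y pr p∤D n)

  two-zeros⇒0<v[a+a] : ∀ m n → m ≢ n → fin 0ℤ <∞ v p (orbitDiff a m) → fin 0ℤ <∞ v p (orbitDiff a n) →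
                 fin 0ℤ <∞ v p (a ℚ.+ a)
  two-zeros⇒0<v[a+a] m n m≢n 0<vₘ 0<vₙ =
    ∣X⇒0<v pr (≐-+ (≐-refl a) (≐-refl a)) p∤D² (subst (+ p ∣_) (identity N D) (∣m⇒∣m*n D p∣2N))
    where
    p∤D : ¬ + p ∣ D
    p∤D p∣D = <∞-asym (v<0⇒v-orbit<0 (∣↧⇒v<0 a pr (∣⇒∣ᵤ p∣D)) m) 0<vₘ
    p∤D² : ¬ + p ∣ D * D
    p∤D² p∣D² = [ p∤D , p∤D ]′ (euclidsLemmaℤ pr D D p∣D²)
    p∣A : ∀ k → fin 0ℤ <∞ v p (orbitDiff a k) → + p ∣ A k
    p∣A k = 0<v⇒∣X pr (orbit≐ k) (∤D⇒∤Y pr p∤D k)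
    p∣2N : + p ∣ + 2 * N
    p∣2N with ℕP.<-cmp m n
    ... | tri< m<n _ _ = ∣A-twice⇒∣2N pr p∤D m<n (p∣A m 0<vₘ) (p∣A n 0<vₙ)
    ... | tri≈ _ m≡n _ = contradiction m≡n m≢n
    ... | tri> _ _ n<m = ∣A-twice⇒∣2N pr p∤D n<m (p∣A n 0<vₙ) (p∣A m 0<vₘ)
    identity : ∀ N D → + 2 * N * D ≡ N * D + N * D
    identity = solve-∀

module TwoAdicOrbit (a : ℚ) where
  open import Data.Nat.Base as ℕ using (suc; _≥_)
  open import Data.Nat.Divisibility using (_∣_; _∤_)
  open import Data.Nat.Primality using (prime[2])
  open import Data.Integer.Base using (+_; 0ℤ; 1ℤ)
  open import Data.Integer.Divisibility.Signed using () renaming (_∣_ to _∣ℤ_)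
  open import Data.Rational.Base using (↥_; ↧_)
  open import Data.Product using (_×_; _,_; proj₁; proj₂; uncurry)
  open import Function.Base using (_∘_)
  open import Relation.Nullary using (¬_)
  open import Relation.Binary.PropositionalEquality using (_≡_)
  open Fraction
  open Valuationℚ
  open Congruence
  open Alternation
  open Orbit a

  private
    N = ↥ a

  module _ (2∤D : ¬ + 2 ∣ℤ ↧ a) where
    private
      2∤Y : ∀ n → ¬ + 2 ∣ℤ Y n
      2∤Y = ∤D⇒∤Y prime[2] 2∤D

      g-odd : ∀ n → g n ≡ 1ℤ [mod + 2 ]
      g-odd n = ∤⇒odd (∤D⇒∤g prime[2] 2∤D n)

      Y-odd : ∀ n → Y n ≡ 1ℤ [mod + 2 ]
      Y-odd n = ∤⇒odd (2∤Y n)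

    even⇒0<v : ∀ n → A n ≡ 0ℤ [mod + 2 ] → fin 0ℤ <∞ v 2 (orbitDiff a n)
    even⇒0<v n A≡0 = ∣X⇒0<v prime[2] (orbit≐ n) (2∤Y n) (even⇒∣ A≡0)

    odd⇒v≡0 : ∀ n → A n ≡ 1ℤ [mod + 2 ] → v 2 (orbitDiff a n) ≡ fin 0ℤ
    odd⇒v≡0 n A≡1 = ∤X⇒v≡0 prime[2] (orbit≐ n) (2∤Y n) (odd⇒∤ A≡1)

    ≡2[mod4]⇒v≡1 : ∀ n → A n ≡ + 2 [mod + 4 ] → v 2 (orbitDiff a n) ≡ fin (+ 1)
    ≡2[mod4]⇒v≡1 n A≡2 = uncurry (p∥X⇒v≡1 prime[2] (orbit≐ n) (2∤Y n)) (≡2[mod4]⇒ A≡2)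

    ≡4[mod8]⇒v≡2 : ∀ n → A n ≡ + 4 [mod + 8 ] → v 2 (orbitDiff a n) ≡ fin (+ 2)
    ≡4[mod8]⇒v≡2 n A≡4 = uncurry (p²∥X⇒v≡2 prime[2] (orbit≐ n) (2∤Y n)) (≡4[mod8]⇒ A≡4)

    A-mod-2-N-even : N ≡ 0ℤ [mod + 2 ] →
                     (∀ n → 2 ∣ n → A n ≡ 0ℤ [mod + 2 ]) × (∀ n → 2 ∤ n → A n ≡ 1ℤ [mod + 2 ])
    A-mod-2-N-even N≡0 = alternating (neg-even N≡0)
      (λ {n} A≡0 → step-even {N = N} {g n} A≡0 (Y-odd n))
      (λ {n} A≡1 → step-odd-N-even {g = g n} A≡1 N≡0 (Y-odd n))

    A-mod-4-N-odd : N ≡ 1ℤ [mod + 2 ] →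
                    (∀ n → 2 ∣ n → A n ≡ 1ℤ [mod + 2 ]) × (∀ n → 2 ∤ n → A n ≡ + 2 [mod + 4 ])
    A-mod-4-N-odd N≡1 = alternating (neg-odd N≡1)
      (λ {n} A≡1 → step-odd-N-odd A≡1 N≡1 (g-odd n) (Y-odd n))
      (λ {n} A≡2 → step-even {N = N} {g n} (∣⇒even (proj₁ (≡2[mod4]⇒ A≡2))) (Y-odd n))

    A-mod-8-N≡2 : N ≡ + 2 [mod + 4 ] → ∀ n → 2 ∤ n → A (suc n) ≡ + 4 [mod + 8 ]
    A-mod-8-N≡2 N≡2 n 2∤n = step-odd-N≡2 A≡1 N≡2 (g-odd n) (Y-odd n)
      where A≡1 = proj₂ (A-mod-2-N-even (∣⇒even (proj₁ (≡2[mod4]⇒ N≡2)))) n 2∤n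

  v₂-orbit-0<v₂a : fin 0ℤ <∞ v 2 a →
    (∀ n → n ≥ 2 → 2 ∣ n → fin 0ℤ <∞ v 2 (orbitDiff a n)) × (∀ n → n ≥ 1 → 2 ∤ n → v 2 (orbitDiff a n) ≡ fin 0ℤ)
  v₂-orbit-0<v₂a 0<v with 0<v⇒∤↧×∣↥ a prime[2] 0<v
  ... | 2∤D , 2∣N = (λ n _ → even⇒0<v 2∤D n ∘ proj₁ orbit n) , (λ n _ → odd⇒v≡0 2∤D n ∘ proj₂ orbit n)
    where orbit = A-mod-2-N-even 2∤D (∣⇒even 2∣N)

  v₂-orbit-v₂a≡1 : v 2 a ≡ fin (+ 1) →
    (∀ n → n ≥ 2 → 2 ∣ n → v 2 (orbitDiff a n) ≡ fin (+ 2)) × (∀ n → n ≥ 1 → 2 ∤ n → v 2 (orbitDiff a n) ≡ fin 0ℤ)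
  v₂-orbit-v₂a≡1 v≡1 with v≡1⇒∤↧×p∥↥ a prime[2] v≡1
  ... | 2∤D , 2∣N , 4∤N = even , (λ n _ → odd⇒v≡0 2∤D n ∘ proj₂ (A-mod-2-N-even 2∤D (∣⇒even 2∣N)) n)
    where
    even : ∀ n → n ≥ 2 → 2 ∣ n → v 2 (orbitDiff a n) ≡ fin (+ 2)
    even (suc m) _ 2∣n = ≡4[mod8]⇒v≡2 2∤D (suc m) (A-mod-8-N≡2 2∤D (∣∤⇒≡2[mod4] 2∣N 4∤N) m (∣suc⇒∤ 2∣n))

  v₂-orbit-v₂a≡0 : v 2 a ≡ fin 0ℤ →
    (∀ n → n ≥ 1 → 2 ∤ n → v 2 (orbitDiff a n) ≡ fin (+ 1)) × (∀ n → 2 ∣ n → v 2 (orbitDiff a n) ≡ fin 0ℤ)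
  v₂-orbit-v₂a≡0 v≡0 with v≡0⇒∤↧×∤↥ a prime[2] v≡0
  ... | 2∤D , 2∤N = (λ n _ → ≡2[mod4]⇒v≡1 2∤D n ∘ proj₂ orbit n) , (λ n → odd⇒v≡0 2∤D n ∘ proj₁ orbit n)
    where orbit = A-mod-4-N-odd 2∤D (∤⇒odd 2∤N)

open import Data.Nat using (ℕ; _≥_)
open import Data.Nat.Divisibility using (_∣_; _∤_)
open import Data.Nat.Primality using (Prime)
open import Data.Integer using (+_)
open import Data.Rational using (ℚ; _+_)
open import Data.Product using (_×_; ∃-syntax)
open import Relation.Binary.PropositionalEquality using (_≡_; _≢_)
open import Function.Bundles using (_⇔_)

open import Data.Nat using (s≤s; z≤n)
open import Data.Product using (_,_)
open import Function.Bundles using (mk⇔)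

proposition3p4 : (a : ℚ) (p : ℕ) → Prime p →
    -- (1)
    ((v p a <∞ fin (+ 0)) ⇔ (∃[ n ] (n ≥ 1 × v p (orbitDiff a n) <∞ fin (+ 0))))
    × ((∃[ n ] (n ≥ 1 × v p (orbitDiff a n) <∞ fin (+ 0)))
         ⇔ (∀ n → n ≥ 1 → v p (orbitDiff a n) <∞ fin (+ 0)))
    -- (2)
    × (fin (+ 0) <∞ v 2 a →
         (∀ n → n ≥ 2 → 2 ∣ n → fin (+ 0) <∞ v 2 (orbitDiff a n))
         × (∀ n → n ≥ 1 → 2 ∤ n → v 2 (orbitDiff a n) ≡ fin (+ 0)))
    -- (3)
    × (v 2 a ≡ fin (+ 1) →
         (∀ n → n ≥ 2 → 2 ∣ n → v 2 (orbitDiff a n) ≡ fin (+ 2))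
         × (∀ n → n ≥ 1 → 2 ∤ n → v 2 (orbitDiff a n) ≡ fin (+ 0)))
    -- (4)
    × (v 2 a ≡ fin (+ 0) →
         (∀ n → n ≥ 1 → 2 ∤ n → v 2 (orbitDiff a n) ≡ fin (+ 1))
         × (∀ n → 2 ∣ n → v 2 (orbitDiff a n) ≡ fin (+ 0)))
    -- (5)
    × (∀ m n → m ≥ 1 → n ≥ 1 → m ≢ n →
         fin (+ 0) <∞ v p (orbitDiff a m) →
         fin (+ 0) <∞ v p (orbitDiff a n) →
         fin (+ 0) <∞ v p (a + a))
-- The lower bounds on m and n are only needed in the even case of (3).
proposition3p4 a p pr =
    mk⇔ (λ v<0 → 1 , s≤s z≤n , v<0⇒v-orbit<0 v<0 1) (λ (n , _ , v<0) → v-orbit<0⇒v<0 n v<0)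
  , mk⇔ (λ (n , _ , v<0) m _ → v<0⇒v-orbit<0 (v-orbit<0⇒v<0 n v<0) m) (λ v<0 → 1 , s≤s z≤n , v<0 1 (s≤s z≤n))
  , v₂-orbit-0<v₂a , v₂-orbit-v₂a≡1 , v₂-orbit-v₂a≡0
  , λ m n _ _ → two-zeros⇒0<v[a+a] m n
  where
  open PAdicOrbit a pr
  open TwoAdicOrbit a
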